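{- For every integer $n\ge 4$, the $(2,2)$ broadcast domination number of the $4\times n$ grid graph satisfies \[\gamma_{2,2}(G_{4,n})=2n-\left\lceil \frac{n-6}{4}\right\rceil .\]
   Context: For positive integers $m,n$, $G_{m,n}$ denotes the $m\times n$ grid graph (the Cartesian product of a path on $m$ vertices and a path on $n$ vertices). For a graph $G=(V,E)$ with shortest-path distance $d$ and integers $1\le r\le t$, the reception strength of $u\in V$ with respect to $S\subseteq V$ is $r(u)=\sum_{v\in S,\ d(u,v)<t}\bigl(t-d(u,v)\bigr)$. A set $S\subseteq V$ is a $(t,r)$ broadcast dominating set if $r(u)\ge r$ for every $u\in V$. The $(t,r)$ broadcast domination number $\gamma_{t,r}(G)$ is the minimum cardinality of a $(t,r)$ broadcast dominating set of $G$. -}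

module Defs where

open import Data.Nat using (ℕ; zero; suc; _+_; _*_; _∸_; _≤_; _<_; _<ᵇ_; NonZero)
open import Relation.Binary.PropositionalEquality using (_≡_)
open import Data.Fin using (Fin; toℕ)
open import Data.Bool using (Bool; true; false; if_then_else_; _∧_)
open import Data.Product using (Σ; _×_; _,_)
open import Data.List using (List; map; concatMap)
open import Data.Nat.ListAction using (sum)
open import Data.List using () renaming (allFin to allFinL)
open import Data.Integer using (ℤ; -_; _/ℕ_)

∣_-_∣ : ℕ → ℕ → ℕ
∣ zero - b ∣ = b
∣ suc a - zero ∣ = suc a
∣ suc a - suc b ∣ = ∣ a - b ∣

Vertex : ℕ → ℕ → Set
Vertex m n = Fin m × Fin n

vertices : (m n : ℕ) → List (Vertex m n)
vertices m n = concatMap (λ i → map (λ j → (i , j)) (allFinL n)) (allFinL m)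

-- Shortest-path distance in the grid graph G_{m,n}: the distance in a
-- Cartesian product of paths is the sum of the path distances (Manhattan).
dist : {m n : ℕ} → Vertex m n → Vertex m n → ℕ
dist (i , j) (i' , j') = ∣ toℕ i - toℕ i' ∣ + ∣ toℕ j - toℕ j' ∣

VSubset : ℕ → ℕ → Set
VSubset m n = Vertex m n → Bool

card : {m n : ℕ} → VSubset m n → ℕ
card {m} {n} S = sum (map (λ v → if S v then 1 else 0) (vertices m n))

reception : {m n : ℕ} → ℕ → VSubset m n → Vertex m n → ℕ
reception {m} {n} t S u =
  sum (map (λ v → if S v ∧ (dist u v <ᵇ t) then t ∸ dist u v else 0) (vertices m n))

IsBroadcastDominating : {m n : ℕ} → ℕ → ℕ → VSubset m n → Set
IsBroadcastDominating {m} {n} t r S = (u : Vertex m n) → r ≤ reception t S u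

IsBroadcastDominationNumber : (m n t r k : ℕ) → Set
IsBroadcastDominationNumber m n t r k =
  (Σ (VSubset m n) λ S → IsBroadcastDominating t r S × card S ≡ k)
  × ((S : VSubset m n) → IsBroadcastDominating t r S → k ≤ card S)

-- ceiling of a / d for an integer a and positive natural d:
-- ⌈a/d⌉ = −⌊(−a)/d⌋  (_/ℕ_ is floor division for a positive divisor)
⌈_/_⌉ : ℤ → (d : ℕ) → .{{NonZero d}} → ℤ
⌈ a / d ⌉ = - ((- a) /ℕ d)

module Submission where

-- With t = 2 a vertex hears only itself (strength 2) and its grid neighbours (strength 1), so a
-- set S dominates exactly when every column, together with the columns on either side of it,
-- gives each of its cells reception at least 2. For the lower bound, a potential ψ on pairs of
-- consecutive columns pays for every further column x after (l, c): 4·|x| ≥ 7 + ψ(c, x) − ψ(l, c).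
-- Telescoping along the grid gives 4|S| ≥ 7n + 3 for n ≥ 3, that is
-- |S| ≥ ⌈(7n + 3)/4⌉ = 2n − ⌈(n − 6)/4⌉. The potential is a shortest-path potential of the graph
-- of column transitions, and its defining inequalities are checked over all columns. For the
-- upper bound, an 8-column block of weight 14 is repeated between fixed end pieces.

open import Defs
open import Data.Nat using (ℕ; zero; suc; _+_; _*_; _^_; _∸_; _≤_; _<_; _<ᵇ_; _≤?_; _/_; _%_; z≤n; s≤s)
open import Data.Nat.Properties
  using (+-identityʳ; +-assoc; +-comm; *-suc; ≤-refl; ≤-reflexive; ≤-trans; <-trans; n<1+n; n≤1+n;
         m≤m+n; m≤n+m; m∸n≤m; +-∸-assoc; *-distribˡ-+; +-mono-≤; +-monoʳ-≤; +-cancelˡ-≤;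
         *-cancelˡ-<; m<1+n⇒m≤n; *-zeroʳ; +-monoˡ-≤; +-monoʳ-<; +-0-commutativeMonoid; module ≤-Reasoning)
open import Data.Nat.DivMod
  using (m≡m%n+[m/n]*n; m%n<n; m<n⇒m%n≡m; m<n⇒m/n≡0; m/n≤m; m*n/n≡m; m/n≡1+[m∸n]/n;
         +-distrib-/; +-distrib-/-∣ʳ)
open import Data.Nat.Divisibility using (n∣m*n)
open import Data.Nat.ListAction using (sum)
open import Data.Nat.ListAction.Properties using (sum-++)
open import Data.Nat.Tactic.RingSolver using (solve-∀)
open import Data.Bool using (Bool; true; false; if_then_else_; _∧_; T)
open import Data.Bool.Properties using (T-∧)
open import Data.Fin using (Fin; zero; suc; toℕ; fromℕ<; combine)
open import Data.Fin.Properties using (all?; toℕ<n; toℕ-fromℕ<)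
open import Data.Unit using (tt)
open import Data.Product using (Σ; _×_; _,_; proj₁; proj₂)
open import Data.List using (List; []; _∷_; map; _++_; tabulate; concatMap; length)
open import Data.List using () renaming (allFin to allFinL)
open import Data.List.Properties using (map-++; map-tabulate; map-∘)
open import Data.Vec using (Vec; []; _∷_; lookup; replicate) renaming (tabulate to tabulateⱽ)
open import Data.Vec.Properties using (lookup∘tabulate; tabulate∘lookup; tabulate-cong; lookup-replicate)
open import Algebra.Properties.CommutativeMonoid.Sum +-0-commutativeMonoid
  using (sum-syntax; sum-cong-≗; sum-replicate-zero; ∑-comm)
open import Function using (_∘_; id)
open import Function.Bundles using (Equivalence)
open import Relation.Nullary using (Dec)
open import Relation.Nullary.Decidable using (⌊_⌋; toWitness; from-yes; map′; _×-dec_; _→-dec_)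
open import Relation.Binary.PropositionalEquality

signal : ℕ → Bool → ℕ
signal d s = if s ∧ (d <ᵇ 2) then 2 ∸ d else 0

rowReception : ℕ → Bool → Bool → Bool → ℕ
rowReception d l c x = signal (d + 1) l + signal d c + signal (d + 1) x

-- A row indexed by ℕ with an offset of one: pad row (suc j) = row j, and pad row k = false for
-- the virtual column k = 0 in front of the grid and for every k beyond it.
pad : ∀ {n} → (Fin n → Bool) → ℕ → Bool
pad row zero = false
pad {zero} row (suc j) = false
pad {suc n} row (suc zero) = row zero
pad {suc n} row (suc (suc j)) = pad (λ k → row (suc k)) (suc j)

pad-suc-toℕ : ∀ {n} (row : Fin n → Bool) j → pad row (suc (toℕ j)) ≡ row j
pad-suc-toℕ row zero = refl
pad-suc-toℕ row (suc j) = pad-suc-toℕ (λ k → row (suc k)) j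

pad-beyond : ∀ {n} (row : Fin n → Bool) {k} → n ≤ k → pad row (suc k) ≡ false
pad-beyond {zero} row _ = refl
pad-beyond {suc n} row (s≤s n≤k) = pad-beyond (λ j → row (suc j)) n≤k

pad-toℕ : ∀ {n} (g : ℕ → Bool) → (∀ k → n ≤ k → g k ≡ false) →
  ∀ k → pad {n} (λ j → g (toℕ j)) (suc k) ≡ g k
pad-toℕ {zero} g vanish k = sym (vanish k z≤n)
pad-toℕ {suc n} g vanish zero = refl
pad-toℕ {suc n} g vanish (suc k) = pad-toℕ (g ∘ suc) (λ k n≤k → vanish (suc k) (s≤s n≤k)) k

signal-≥2 : ∀ {d} s → 2 ≤ d → signal d s ≡ 0
signal-≥2 false (s≤s (s≤s _)) = refl
signal-≥2 true (s≤s (s≤s _)) = refl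

∑-signal-far : ∀ {n} d (row : Fin n → Bool) →
  ∑[ j < n ] signal (d + suc (suc (toℕ j))) (row j) ≡ 0
∑-signal-far {n} d row =
  trans (sum-cong-≗ λ j → signal-≥2 (row j) (≤-trans (s≤s (s≤s z≤n)) (m≤n+m _ d)))
        (sum-replicate-zero n)

∑-signal≡rowReception : ∀ {n} d (row : Fin n → Bool) b →
  ∑[ j < n ] signal (d + ∣ b - toℕ j ∣) (row j)
    ≡ rowReception d (pad row b) (pad row (suc b)) (pad row (suc (suc b)))
∑-signal≡rowReception {zero} d row zero = refl
∑-signal≡rowReception {zero} d row (suc b) = refl
∑-signal≡rowReception {suc n} d row zero =
  cong₂ _+_ (cong (λ e → signal e (row zero)) (+-identityʳ d)) (∑-signal-edge (λ j → row (suc j)))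
  where
  ∑-signal-edge : ∀ {n} (row : Fin n → Bool) →
    ∑[ j < n ] signal (d + suc (toℕ j)) (row j) ≡ signal (d + 1) (pad row 1)
  ∑-signal-edge {zero} row = refl
  ∑-signal-edge {suc n} row =
    trans (cong (signal (d + 1) (row zero) +_) (∑-signal-far d (λ j → row (suc j))))
          (+-identityʳ _)
∑-signal≡rowReception {suc n} d row (suc zero) =
  trans (cong (signal (d + 1) (row zero) +_) (∑-signal≡rowReception d (λ j → row (suc j)) 0))
        (sym (+-assoc (signal (d + 1) (row zero)) (signal d (pad row 2)) (signal (d + 1) (pad row 3))))
∑-signal≡rowReception {suc n} d row (suc (suc b)) =
  cong₂ _+_ (signal-≥2 (row zero) (≤-trans (s≤s (s≤s z≤n)) (m≤n+m _ d)))
            (∑-signal≡rowReception d (λ j → row (suc j)) (suc b))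

-- Reception and cardinality in terms of columns

sum-map-allFin : ∀ k (h : Fin k → ℕ) → sum (map h (allFinL k)) ≡ ∑[ i < k ] h i
sum-map-allFin k h = trans (cong sum (map-tabulate id h)) (sum-tabulate h)
  where
  sum-tabulate : ∀ {k} (h : Fin k → ℕ) → sum (tabulate h) ≡ ∑[ i < k ] h i
  sum-tabulate {zero} h = refl
  sum-tabulate {suc k} h = cong (h zero +_) (sum-tabulate (h ∘ suc))

sum-map-concatMap : ∀ {A B : Set} (F : B → ℕ) (g : A → List B) xs →
  sum (map F (concatMap g xs)) ≡ sum (map (λ x → sum (map F (g x))) xs)
sum-map-concatMap F g [] = refl
sum-map-concatMap F g (x ∷ xs) = begin
  sum (map F (g x ++ concatMap g xs))               ≡⟨ cong sum (map-++ F (g x) _) ⟩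
  sum (map F (g x) ++ map F (concatMap g xs))       ≡⟨ sum-++ (map F (g x)) _ ⟩
  sum (map F (g x)) + sum (map F (concatMap g xs))  ≡⟨ cong (sum (map F (g x)) +_) (sum-map-concatMap F g xs) ⟩
  sum (map F (g x)) + sum (map (λ x → sum (map F (g x))) xs) ∎
  where open ≡-Reasoning

sum-vertices : ∀ {m n} (F : Vertex m n → ℕ) →
  sum (map F (vertices m n)) ≡ ∑[ i < m ] ∑[ j < n ] F (i , j)
sum-vertices {m} {n} F =
  trans (sum-map-concatMap F row (allFinL m))
    (trans (sum-map-allFin m (λ i → sum (map F (row i))))
      (sum-cong-≗ λ i → trans (cong sum (sym (map-∘ (allFinL n)))) (sum-map-allFin n (λ j → F (i , j)))))
  where
  row : Fin m → List (Vertex m n)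
  row i = map (λ j → (i , j)) (allFinL n)

Column : ℕ → Set
Column m = Vec Bool m

blank : ∀ {m} → Column m
blank = replicate _ false

weight : ∀ {m} → Column m → ℕ
weight {m} c = ∑[ i < m ] (if lookup c i then 1 else 0)

localReception : ∀ {m} → Fin m → Column m → Column m → Column m → ℕ
localReception {m} a l c x =
  ∑[ i < m ] rowReception ∣ toℕ a - toℕ i ∣ (lookup l i) (lookup c i) (lookup x i)

-- Column k of S in the padded indexing of pad: columns S (suc j) is column j of the grid.
columns : ∀ {m n} → VSubset m n → ℕ → Column m
columns S k = tabulateⱽ (λ i → pad (λ j → S (i , j)) k)

lookup-columns : ∀ {m n} (S : VSubset m n) i k → lookup (columns S k) i ≡ pad (λ j → S (i , j)) k
lookup-columns S i k = lookup∘tabulate (λ i → pad (λ j → S (i , j)) k) i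

tabulate-blank : ∀ {m} {f : Fin m → Bool} → (∀ i → f i ≡ false) → tabulateⱽ f ≡ blank
tabulate-blank f≡false =
  trans (tabulate-cong (λ i → trans (f≡false i) (sym (lookup-replicate i false)))) (tabulate∘lookup blank)

reception-columns : ∀ {m n} (S : VSubset m n) a j → let b = toℕ j in
  reception 2 S (a , j) ≡ localReception a (columns S b) (columns S (suc b)) (columns S (suc (suc b)))
reception-columns {n = n} S a j =
  trans (sum-vertices (λ v → signal (dist (a , j) v) (S v))) (sum-cong-≗ row-contribution)
  where
  b : ℕ
  b = toℕ j
  row-contribution : ∀ i →
    ∑[ k < n ] signal (∣ toℕ a - toℕ i ∣ + ∣ b - toℕ k ∣) (S (i , k))
      ≡ rowReception ∣ toℕ a - toℕ i ∣ (lookup (columns S b) i) (lookup (columns S (suc b)) i)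
                                      (lookup (columns S (suc (suc b))) i)
  row-contribution i
    rewrite lookup-columns S i b | lookup-columns S i (suc b) | lookup-columns S i (suc (suc b))
    = ∑-signal≡rowReception ∣ toℕ a - toℕ i ∣ (λ k → S (i , k)) b

card-columns : ∀ {m n} (S : VSubset m n) → card S ≡ ∑[ j < n ] weight (columns S (suc (toℕ j)))
card-columns S =
  trans (sum-vertices (λ v → if S v then 1 else 0))
    (trans (∑-comm (λ i j → if S (i , j) then 1 else 0))
      (sum-cong-≗ λ j → sum-cong-≗ λ i → cong (λ b → if b then 1 else 0)
        (sym (trans (lookup-columns S i (suc (toℕ j))) (pad-suc-toℕ (λ j → S (i , j)) j)))))

all-columns? : ∀ {k} {P : Column k → Set} → (∀ c → Dec (P c)) → Dec (∀ c → P c)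
all-columns? {zero} P? = map′ (λ p → λ { [] → p }) (λ f → f []) (P? [])
all-columns? {suc k} P? =
  map′ (λ (f , t) → λ { (false ∷ c) → f c ; (true ∷ c) → t c })
       (λ f → (λ c → f (false ∷ c)) , (λ c → f (true ∷ c)))
       (all-columns? (λ c → P? (false ∷ c)) ×-dec all-columns? (λ c → P? (true ∷ c)))

-- Column-wise view of (2, r) broadcast domination of m × n grids

module ColumnWise (m r : ℕ) where

  Dominated : Column m → Column m → Column m → Set
  Dominated l c x = ∀ a → r ≤ localReception a l c x

  dominated? : ∀ l c x → Dec (Dominated l c x)
  dominated? l c x = all? (λ a → r ≤? localReception a l c x)

  Admissible : ∀ {n} → VSubset m n → Set
  Admissible {n} S = ∀ j → j < n → Dominated (columns S j) (columns S (suc j)) (columns S (suc (suc j)))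

  dominating⇒admissible : ∀ {n} (S : VSubset m n) → IsBroadcastDominating 2 r S → Admissible S
  dominating⇒admissible S dom j j<n a =
    subst (λ b → r ≤ localReception a (columns S b) (columns S (suc b)) (columns S (suc (suc b))))
          (toℕ-fromℕ< j<n)
          (subst (r ≤_) (reception-columns S a (fromℕ< j<n)) (dom (a , fromℕ< j<n)))

  admissible⇒dominating : ∀ {n} (S : VSubset m n) → Admissible S → IsBroadcastDominating 2 r S
  admissible⇒dominating S adm (a , j) =
    subst (r ≤_) (sym (reception-columns S a j)) (adm (toℕ j) (toℕ<n j) a)

  potential-bound : (ψ : Column m → Column m → ℕ) (a b e : ℕ) →
    (∀ l c x → Dominated l c x → ψ c x + a ≤ ψ l c + b * weight x) →
    (∀ l c → Dominated l c blank → e ≤ ψ l c) →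
    ∀ k (D : ℕ → Column m) → (∀ j → j ≤ k → Dominated (D j) (D (suc j)) (D (suc (suc j)))) →
    D (suc (suc k)) ≡ blank →
    e + k * a ≤ ψ (D 0) (D 1) + b * ∑[ j < k ] weight (D (suc (suc (toℕ j))))
  potential-bound ψ a b e pays ends zero D dom last = begin
    e + 0              ≡⟨ +-identityʳ e ⟩
    e                  ≤⟨ ends (D 0) (D 1) (subst (Dominated (D 0) (D 1)) last (dom 0 z≤n)) ⟩
    ψ (D 0) (D 1)      ≡⟨ +-identityʳ _ ⟨
    ψ (D 0) (D 1) + 0  ≡⟨ cong (ψ (D 0) (D 1) +_) (*-zeroʳ b) ⟨
    ψ (D 0) (D 1) + b * 0 ∎
    where open ≤-Reasoning
  potential-bound ψ a b e pays ends (suc k) D dom last = begin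
    e + (a + k * a)                    ≡⟨ shuffle e a (k * a) ⟩
    (e + k * a) + a                    ≤⟨ +-monoˡ-≤ a (potential-bound ψ a b e pays ends k (D ∘ suc)
                                                         (λ j j≤k → dom (suc j) (s≤s j≤k)) last) ⟩
    (ψ₁ + b * later) + a                   ≡⟨ shuffle′ ψ₁ (b * later) a ⟩
    (ψ₁ + a) + b * later                   ≤⟨ +-monoˡ-≤ (b * later) (pays (D 0) (D 1) (D 2) (dom 0 z≤n)) ⟩
    (ψ₀ + b * weight (D 2)) + b * later    ≡⟨ +-assoc ψ₀ _ _ ⟩
    ψ₀ + (b * weight (D 2) + b * later)    ≡⟨ cong (ψ₀ +_) (*-distribˡ-+ b (weight (D 2)) later) ⟨
    ψ₀ + b * (weight (D 2) + later)        ∎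
    where
    open ≤-Reasoning
    ψ₀ ψ₁ later : ℕ
    ψ₀ = ψ (D 0) (D 1)
    ψ₁ = ψ (D 1) (D 2)
    later = ∑[ j < k ] weight (D (suc (suc (suc (toℕ j)))))
    shuffle : ∀ x y z → x + (y + z) ≡ (x + z) + y
    shuffle = solve-∀
    shuffle′ : ∀ x y z → (x + y) + z ≡ (x + z) + y
    shuffle′ = solve-∀

  columnAt : List (Column m) → ℕ → Column m
  columnAt [] k = blank
  columnAt (c ∷ w) zero = c
  columnAt (c ∷ w) (suc k) = columnAt w k

  columnAt-beyond : ∀ w {k} → length w ≤ k → columnAt w k ≡ blank
  columnAt-beyond [] _ = refl
  columnAt-beyond (c ∷ w) (s≤s w≤k) = columnAt-beyond w w≤k

  validFrom : Column m → Column m → List (Column m) → Bool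
  validFrom l c [] = ⌊ dominated? l c blank ⌋
  validFrom l c (x ∷ w) = ⌊ dominated? l c x ⌋ ∧ validFrom c x w

  validFrom-∷ : ∀ l c x w → T (validFrom l c (x ∷ w)) → T ⌊ dominated? l c x ⌋ × T (validFrom c x w)
  validFrom-∷ l c x w = Equivalence.to (T-∧ {⌊ dominated? l c x ⌋} {validFrom c x w})

  validFrom-sound : ∀ l c w → T (validFrom l c w) → ∀ j → j ≤ length w →
    let D = columnAt (l ∷ c ∷ w) in Dominated (D j) (D (suc j)) (D (suc (suc j)))
  validFrom-sound l c [] valid zero _ = toWitness valid
  validFrom-sound l c (x ∷ w) valid zero _ = toWitness (proj₁ (validFrom-∷ l c x w valid))
  validFrom-sound l c (x ∷ w) valid (suc j) (s≤s j≤) =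
    validFrom-sound c x w (proj₂ (validFrom-∷ l c x w valid)) j j≤

  fromWord : (w : List (Column m)) → VSubset m (length w)
  fromWord w (i , j) = lookup (columnAt w (toℕ j)) i

  columns-fromWord : ∀ w k → columns (fromWord w) k ≡ columnAt (blank ∷ w) k
  columns-fromWord w zero = tabulate-blank (λ i → refl)
  columns-fromWord w (suc k) =
    trans (tabulate-cong (λ i → pad-toℕ (λ j → lookup (columnAt w j) i) (vanish i) k))
          (tabulate∘lookup (columnAt w k))
    where
    vanish : ∀ i j → length w ≤ j → lookup (columnAt w j) i ≡ false
    vanish i j w≤j = trans (cong (λ c → lookup c i) (columnAt-beyond w w≤j)) (lookup-replicate i false)

  cost : List (Column m) → ℕ
  cost w = sum (map weight w)

  ∑-columnAt : ∀ w → ∑[ j < length w ] weight (columnAt w (toℕ j)) ≡ cost w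
  ∑-columnAt [] = refl
  ∑-columnAt (c ∷ w) = cong (weight c +_) (∑-columnAt w)

  fromWord-realises : ∀ c w → T (validFrom blank c w) →
    Σ (VSubset m (length (c ∷ w))) λ S → IsBroadcastDominating 2 r S × card S ≡ cost (c ∷ w)
  fromWord-realises c w valid =
    fromWord (c ∷ w) , admissible⇒dominating (fromWord (c ∷ w)) admissible ,
    trans (card-columns (fromWord (c ∷ w)))
      (trans (sum-cong-≗ {length (c ∷ w)} λ j → cong weight (columns-fromWord (c ∷ w) (suc (toℕ j))))
             (∑-columnAt (c ∷ w)))
    where
    admissible : Admissible (fromWord (c ∷ w))
    admissible j (s≤s j≤)
      rewrite columns-fromWord (c ∷ w) j | columns-fromWord (c ∷ w) (suc j)
            | columns-fromWord (c ∷ w) (suc (suc j)) = validFrom-sound blank c w valid j j≤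

-- The closed form

γ : ℕ → ℕ
γ n = 2 * n ∸ (n ∸ 3) / 4

[n∸3]/4≤2*n : ∀ n → (n ∸ 3) / 4 ≤ 2 * n
[n∸3]/4≤2*n n = ≤-trans (m/n≤m (n ∸ 3) 4) (≤-trans (m∸n≤m n 3) (m≤m+n n (n + 0)))

γ-periodic : ∀ {n} → 3 ≤ n → γ (4 + n) ≡ 7 + γ n
γ-periodic {n} 3≤n = begin
  2 * (4 + n) ∸ suc n / 4      ≡⟨ cong₂ _∸_ (*-distribˡ-+ 2 4 n) (m/n≡1+[m∸n]/n (s≤s 3≤n)) ⟩
  (7 + 2 * n) ∸ (n ∸ 3) / 4    ≡⟨ +-∸-assoc 7 ([n∸3]/4≤2*n n) ⟩
  7 + γ n                      ∎
  where open ≡-Reasoning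

4*γ≤7*n+6 : ∀ j → 4 * γ (3 + j) ≤ 7 * (3 + j) + 6
4*γ≤7*n+6 0 = m≤m+n 24 3
4*γ≤7*n+6 1 = m≤m+n 32 2
4*γ≤7*n+6 2 = m≤m+n 40 1
4*γ≤7*n+6 3 = ≤-refl
4*γ≤7*n+6 (suc (suc (suc (suc j)))) = begin
  4 * γ (4 + (3 + j))         ≡⟨ cong (4 *_) (γ-periodic {3 + j} (s≤s (s≤s (s≤s z≤n)))) ⟩
  4 * (7 + γ (3 + j))         ≡⟨ *-distribˡ-+ 4 7 (γ (3 + j)) ⟩
  28 + 4 * γ (3 + j)          ≤⟨ +-monoʳ-≤ 28 (4*γ≤7*n+6 j) ⟩
  28 + (7 * (3 + j) + 6)      ≡⟨ +-assoc 28 (7 * (3 + j)) 6 ⟨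
  28 + 7 * (3 + j) + 6        ≡⟨ cong (_+ 6) (*-distribˡ-+ 7 4 (3 + j)) ⟨
  7 * (4 + (3 + j)) + 6       ∎
  where open ≤-Reasoning

7*n+3≤4*k⇒γ≤k : ∀ j {k} → 7 * (3 + j) + 3 ≤ 4 * k → γ (3 + j) ≤ k
7*n+3≤4*k⇒γ≤k j {k} bound = m<1+n⇒m≤n (*-cancelˡ-< 4 (γ (3 + j)) (suc k) (begin-strict
  4 * γ (3 + j)         ≤⟨ 4*γ≤7*n+6 j ⟩
  7 * (3 + j) + 6       <⟨ +-monoʳ-< (7 * (3 + j)) (n<1+n 6) ⟩
  7 * (3 + j) + 7       ≡⟨ +-assoc (7 * (3 + j)) 3 4 ⟨
  7 * (3 + j) + 3 + 4   ≤⟨ +-monoˡ-≤ 4 bound ⟩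
  4 * k + 4             ≡⟨ +-comm (4 * k) 4 ⟩
  4 + 4 * k             ≡⟨ *-suc 4 k ⟨
  4 * suc k             ∎))
  where open ≤-Reasoning

-- Opened only here: with ℤ's +_ in scope, sections such as (k +_) no longer parse.
open import Data.Integer using (+_; _-_; _⊖_)
open import Data.Integer.Properties using (neg-involutive; [+m]-[+n]≡m⊖n; ⊖-≥)

⌈+m/[1+d]⌉ : ∀ m d → ⌈ + m / suc d ⌉ ≡ + ((d + m) / suc d)
⌈+m/[1+d]⌉ zero d = cong +_ (sym (m<n⇒m/n≡0 (s≤s (≤-reflexive (+-identityʳ d)))))
⌈+m/[1+d]⌉ (suc x) d with suc x % suc d in eq
... | zero = trans (neg-involutive _) (cong +_ (sym (begin
  (d + suc x) / suc d              ≡⟨ cong (_/ suc d) (+-comm d (suc x)) ⟩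
  (suc x + d) / suc d              ≡⟨ +-distrib-/ (suc x) d fits ⟩
  suc x / suc d + d / suc d        ≡⟨ cong (λ z → suc x / suc d + z) (m<n⇒m/n≡0 (n<1+n d)) ⟩
  suc x / suc d + 0                ≡⟨ +-identityʳ _ ⟩
  suc x / suc d                    ∎)))
  where
  open ≡-Reasoning
  fits : suc x % suc d + d % suc d < suc d
  fits rewrite eq | m<n⇒m%n≡m (n<1+n d) = n<1+n d
... | suc ρ = cong +_ (sym (begin
  (d + suc x) / suc d                ≡⟨ cong (_/ suc d) shape ⟩
  (ρ + suc q * suc d) / suc d        ≡⟨ +-distrib-/-∣ʳ ρ (n∣m*n (suc q)) ⟩
  ρ / suc d + suc q * suc d / suc d  ≡⟨ cong₂ _+_ (m<n⇒m/n≡0 ρ<1+d) (m*n/n≡m (suc q) (suc d)) ⟩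
  suc q                              ∎))
  where
  open ≡-Reasoning
  q : ℕ
  q = suc x / suc d
  ρ<1+d : ρ < suc d
  ρ<1+d = <-trans (n<1+n ρ) (subst (_< suc d) eq (m%n<n (suc x) (suc d)))
  swap : ∀ a b c → a + (suc b + c) ≡ b + (suc a + c)
  swap = solve-∀
  division : suc x ≡ suc ρ + q * suc d
  division = trans (m≡m%n+[m/n]*n (suc x) (suc d)) (cong (_+ q * suc d) eq)
  shape : d + suc x ≡ ρ + suc q * suc d
  shape = trans (cong (λ z → d + z) division) (swap d ρ (q * suc d))

⌈n-6/4⌉ : ∀ {n} → 3 ≤ n → ⌈ + n - + 6 / 4 ⌉ ≡ + ((n ∸ 3) / 4)
⌈n-6/4⌉ {1} (s≤s ())
⌈n-6/4⌉ {2} (s≤s (s≤s ()))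
⌈n-6/4⌉ {3} _ = refl
⌈n-6/4⌉ {4} _ = refl
⌈n-6/4⌉ {5} _ = refl
⌈n-6/4⌉ {suc (suc (suc (suc (suc (suc m)))))} _ = ⌈+m/[1+d]⌉ m 3

γ-formula : ∀ {n} → 3 ≤ n → + γ n ≡ + (2 * n) - ⌈ + n - + 6 / 4 ⌉
γ-formula {n} 3≤n = begin
  + γ n                           ≡⟨ ⊖-≥ ([n∸3]/4≤2*n n) ⟨
  2 * n ⊖ (n ∸ 3) / 4             ≡⟨ [+m]-[+n]≡m⊖n (2 * n) ((n ∸ 3) / 4) ⟨
  + (2 * n) - + ((n ∸ 3) / 4)     ≡⟨ cong (λ z → + (2 * n) - z) (⌈n-6/4⌉ 3≤n) ⟨
  + (2 * n) - ⌈ + n - + 6 / 4 ⌉   ∎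
  where open ≡-Reasoning

-- The 4 × n grid

open ColumnWise 4 2

index : ∀ {k} → Column k → Fin (2 ^ k)
index [] = zero
index (b ∷ c) = combine {2} (if b then suc zero else zero) (index c)

-- ψ l c is the entry in row index l and column index c of the matrix (index reads a column as a
-- binary number, top cell first). It is the shortest-path potential φ of the column transitions
-- shifted by 5, so ψ-ends and ψ-starts below say φ ≥ 3 and φ(c₂, c₃) + 21 ≤ 4(|c₁| + |c₂| + |c₃|).
-- An entry 35 marks a pair (l, c) in which column l cannot be dominated whatever precedes it.
ψ : Column 4 → Column 4 → ℕ
ψ l c = lookup (lookup potential (index l)) (index c)
  where
  potential : Vec (Vec ℕ 16) 16
  potential =
    (35 ∷ 35 ∷ 35 ∷ 35 ∷ 35 ∷ 35 ∷ 35 ∷ 35 ∷ 35 ∷ 35 ∷ 35 ∷ 35 ∷ 35 ∷ 35 ∷ 35 ∷ 15 ∷ []) ∷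
    (35 ∷ 35 ∷ 35 ∷ 35 ∷ 35 ∷ 35 ∷ 35 ∷ 35 ∷ 35 ∷ 35 ∷ 35 ∷ 35 ∷  7 ∷ 11 ∷ 10 ∷ 14 ∷ []) ∷
    (35 ∷ 35 ∷ 35 ∷ 35 ∷ 35 ∷ 35 ∷ 35 ∷ 35 ∷  3 ∷  7 ∷  7 ∷ 11 ∷  5 ∷  9 ∷  9 ∷ 13 ∷ []) ∷
    (35 ∷ 35 ∷ 35 ∷ 35 ∷ 35 ∷ 35 ∷ 35 ∷ 35 ∷  5 ∷  9 ∷  9 ∷ 13 ∷  8 ∷ 12 ∷ 12 ∷ 16 ∷ []) ∷
    (35 ∷  3 ∷ 35 ∷  5 ∷ 35 ∷  7 ∷ 35 ∷  9 ∷ 35 ∷  7 ∷ 35 ∷  9 ∷ 35 ∷ 11 ∷ 35 ∷ 13 ∷ []) ∷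
    ( 0 ∷  4 ∷  4 ∷  8 ∷  4 ∷  8 ∷  8 ∷ 12 ∷  4 ∷  8 ∷  8 ∷ 12 ∷  8 ∷ 12 ∷ 12 ∷ 16 ∷ []) ∷
    ( 0 ∷  4 ∷  4 ∷  8 ∷  4 ∷  8 ∷  8 ∷ 12 ∷  4 ∷  8 ∷  8 ∷ 12 ∷  8 ∷ 12 ∷ 12 ∷ 16 ∷ []) ∷
    ( 3 ∷  7 ∷  7 ∷ 11 ∷  7 ∷ 11 ∷ 11 ∷ 15 ∷  6 ∷ 10 ∷ 10 ∷ 14 ∷ 10 ∷ 14 ∷ 14 ∷ 18 ∷ []) ∷
    (35 ∷ 35 ∷ 35 ∷  7 ∷ 35 ∷ 35 ∷ 35 ∷ 10 ∷ 35 ∷ 35 ∷ 35 ∷ 11 ∷ 35 ∷ 35 ∷ 35 ∷ 14 ∷ []) ∷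
    ( 0 ∷  4 ∷  4 ∷  8 ∷  4 ∷  8 ∷  8 ∷ 12 ∷  4 ∷  8 ∷  8 ∷ 12 ∷  8 ∷ 12 ∷ 12 ∷ 16 ∷ []) ∷
    ( 0 ∷  4 ∷  4 ∷  8 ∷  4 ∷  8 ∷  8 ∷ 12 ∷  4 ∷  8 ∷  8 ∷ 12 ∷  8 ∷ 12 ∷ 12 ∷ 16 ∷ []) ∷
    ( 2 ∷  6 ∷  6 ∷ 10 ∷  6 ∷ 10 ∷ 10 ∷ 14 ∷  6 ∷ 10 ∷ 10 ∷ 14 ∷ 10 ∷ 14 ∷ 14 ∷ 18 ∷ []) ∷
    (35 ∷  5 ∷ 35 ∷  8 ∷ 35 ∷  9 ∷ 35 ∷ 12 ∷ 35 ∷  9 ∷ 35 ∷ 12 ∷ 35 ∷ 13 ∷ 35 ∷ 16 ∷ []) ∷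
    ( 2 ∷  6 ∷  6 ∷ 10 ∷  6 ∷ 10 ∷ 10 ∷ 14 ∷  6 ∷ 10 ∷ 10 ∷ 14 ∷ 10 ∷ 14 ∷ 14 ∷ 18 ∷ []) ∷
    ( 3 ∷  6 ∷  7 ∷ 10 ∷  7 ∷ 10 ∷ 11 ∷ 14 ∷  7 ∷ 10 ∷ 11 ∷ 14 ∷ 11 ∷ 14 ∷ 15 ∷ 18 ∷ []) ∷
    ( 6 ∷ 10 ∷ 10 ∷ 14 ∷ 10 ∷ 14 ∷ 14 ∷ 18 ∷ 10 ∷ 14 ∷ 14 ∷ 18 ∷ 14 ∷ 18 ∷ 18 ∷ 22 ∷ []) ∷ []

ψ-pays : ∀ l c x → Dominated l c x → ψ c x + 7 ≤ ψ l c + 4 * weight x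
ψ-pays = from-yes (all-columns? λ l → all-columns? λ c → all-columns? λ x →
  dominated? l c x →-dec ψ c x + 7 ≤? ψ l c + 4 * weight x)

ψ-ends : ∀ l c → Dominated l c blank → 8 ≤ ψ l c
ψ-ends = from-yes (all-columns? λ l → all-columns? λ c → dominated? l c blank →-dec 8 ≤? ψ l c)

-- The first three columns are paid for together because 4|S| ≥ 7n + 3 fails for n = 2.
ψ-starts : ∀ c₁ c₂ c₃ → Dominated blank c₁ c₂ → Dominated c₁ c₂ c₃ →
  ψ c₂ c₃ + 16 ≤ 4 * (weight c₁ + weight c₂ + weight c₃)
ψ-starts = from-yes (all-columns? λ c₁ → all-columns? λ c₂ → all-columns? λ c₃ →
  dominated? blank c₁ c₂ →-dec dominated? c₁ c₂ c₃ →-dec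
  ψ c₂ c₃ + 16 ≤? 4 * (weight c₁ + weight c₂ + weight c₃))

7*n+3≤4*card : ∀ k (S : VSubset 4 (3 + k)) → IsBroadcastDominating 2 2 S → 7 * (3 + k) + 3 ≤ 4 * card S
7*n+3≤4*card k S dom =
  subst (λ s → 7 * (3 + k) + 3 ≤ 4 * s) (sym (card-columns S))
    (+-cancelˡ-≤ ψ₂₃ _ _
      (subst₂ _≤_ (regroupˡ k ψ₂₃) (regroupʳ ψ₂₃ later (weight (D 1)) (weight (D 2)) (weight (D 3)))
                  (+-mono-≤ tail head)))
  where
  D : ℕ → Column 4
  D = columns S
  admissible : Admissible S
  admissible = dominating⇒admissible S dom
  ψ₂₃ later : ℕ
  ψ₂₃ = ψ (D 2) (D 3)
  later = ∑[ j < k ] weight (D (suc (suc (suc (suc (toℕ j))))))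
  tail : 8 + k * 7 ≤ ψ₂₃ + 4 * later
  tail = potential-bound ψ 7 4 8 ψ-pays ψ-ends k (λ j → D (suc (suc j)))
           (λ j j≤k → admissible (suc (suc j)) (s≤s (s≤s (s≤s j≤k))))
           (tabulate-blank (λ i → pad-beyond (λ j → S (i , j)) {suc (suc (suc k))} ≤-refl))
  head : ψ₂₃ + 16 ≤ 4 * (weight (D 1) + weight (D 2) + weight (D 3))
  head = ψ-starts (D 1) (D 2) (D 3)
           (subst (λ l → Dominated l (D 1) (D 2)) (tabulate-blank (λ i → refl)) (admissible 0 (s≤s z≤n)))
           (admissible 1 (s≤s (s≤s z≤n)))
  regroupˡ : ∀ k p → (8 + k * 7) + (p + 16) ≡ p + (7 * (3 + k) + 3)
  regroupˡ = solve-∀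
  regroupʳ : ∀ p s x y z → (p + 4 * s) + 4 * (x + y + z) ≡ p + 4 * (x + (y + (z + s)))
  regroupʳ = solve-∀

lower-bound : ∀ {n} → 3 ≤ n → (S : VSubset 4 n) → IsBroadcastDominating 2 2 S → γ n ≤ card S
lower-bound {suc (suc (suc k))} (s≤s (s≤s (s≤s z≤n))) S dom = 7*n+3≤4*k⇒γ≤k k (7*n+3≤4*card k S dom)

■ □ : Bool
■ = true
□ = false

□■□■ ■□□■ □□■□ ■■□■ □■□□ ■□■■ □□□■ ■■■□ ■■□□ □□■■ ■□■□ : Column 4
□■□■ = □ ∷ ■ ∷ □ ∷ ■ ∷ []
■□□■ = ■ ∷ □ ∷ □ ∷ ■ ∷ []
□□■□ = □ ∷ □ ∷ ■ ∷ □ ∷ []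
■■□■ = ■ ∷ ■ ∷ □ ∷ ■ ∷ []
□■□□ = □ ∷ ■ ∷ □ ∷ □ ∷ []
■□■■ = ■ ∷ □ ∷ ■ ∷ ■ ∷ []
□□□■ = □ ∷ □ ∷ □ ∷ ■ ∷ []
■■■□ = ■ ∷ ■ ∷ ■ ∷ □ ∷ []
■■□□ = ■ ∷ ■ ∷ □ ∷ □ ∷ []
□□■■ = □ ∷ □ ∷ ■ ∷ ■ ∷ []
■□■□ = ■ ∷ □ ∷ ■ ∷ □ ∷ []

prefix period : List (Column 4)
prefix = □■□■ ∷ ■□□■ ∷ □□■□ ∷ ■■□■ ∷ []
period = □□■□ ∷ ■□□■ ∷ □■□□ ∷ ■□■■ ∷ □■□□ ∷ ■□□■ ∷ □□■□ ∷ ■■□■ ∷ []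

suffix : ℕ → List (Column 4)
suffix 0 = []
suffix 1 = □■□■ ∷ []
suffix 2 = □□□■ ∷ ■■■□ ∷ []
suffix 3 = □□■□ ∷ ■□□■ ∷ □■□■ ∷ []
suffix 4 = □□■□ ∷ ■□□■ ∷ □■□□ ∷ ■□■■ ∷ []
suffix 5 = □□□■ ∷ ■■■□ ∷ □□■□ ∷ ■□□■ ∷ □■□■ ∷ []
suffix 6 = □□□■ ∷ ■■■□ ∷ □□□■ ∷ ■■□□ ∷ □□■■ ∷ ■□■□ ∷ []
suffix 7 = □□■□ ∷ ■□□■ ∷ □■□□ ∷ ■□■■ ∷ □■□□ ∷ □■□■ ∷ ■□■□ ∷ []
suffix (suc (suc (suc (suc (suc (suc (suc (suc j)))))))) = period ++ suffix j

-- prefix and period both end in □□■□ ■■□■, and period is admissible after these two columns,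
-- so validFrom □□■□ ■■□■ (period ++ w) computes to validFrom □□■□ ■■□■ w.
suffix-spec : ∀ j →
  T (validFrom □□■□ ■■□■ (suffix j)) × length (suffix j) ≡ j × cost (prefix ++ suffix j) ≡ γ (4 + j)
suffix-spec 0 = tt , refl , refl
suffix-spec 1 = tt , refl , refl
suffix-spec 2 = tt , refl , refl
suffix-spec 3 = tt , refl , refl
suffix-spec 4 = tt , refl , refl
suffix-spec 5 = tt , refl , refl
suffix-spec 6 = tt , refl , refl
suffix-spec 7 = tt , refl , refl
suffix-spec (suc (suc (suc (suc (suc (suc (suc (suc j)))))))) with suffix-spec j
... | valid , length≡j , cost≡γ = valid , cong (λ l → 8 + l) length≡j , (begin
  14 + cost (prefix ++ suffix j)  ≡⟨ cong (λ c → 14 + c) cost≡γ ⟩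
  14 + γ (4 + j)                  ≡⟨ cong (λ g → 7 + g) (γ-periodic {4 + j} (s≤s (s≤s (s≤s z≤n)))) ⟨
  7 + γ (8 + j)                   ≡⟨ γ-periodic {8 + j} (s≤s (s≤s (s≤s z≤n))) ⟨
  γ (12 + j)                      ∎)
  where open ≡-Reasoning

upper-bound : ∀ {n} → 4 ≤ n → Σ (VSubset 4 n) λ S → IsBroadcastDominating 2 2 S × card S ≡ γ n
upper-bound {suc (suc (suc (suc j)))} (s≤s (s≤s (s≤s (s≤s z≤n)))) with suffix-spec j
... | valid , length≡j , cost≡γ =
  subst₂ (λ n k → Σ (VSubset 4 n) λ S → IsBroadcastDominating 2 2 S × card S ≡ k)
         (cong (λ l → 4 + l) length≡j) cost≡γ
         (fromWord-realises □■□■ (■□□■ ∷ □□■□ ∷ ■■□■ ∷ suffix j) valid)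

mainTheorem2 : (n : ℕ) → 4 ≤ n →
    Σ ℕ λ k → IsBroadcastDominationNumber 4 n 2 2 k
      × (+ k ≡ + (2 * n) - ⌈ + n - + 6 / 4 ⌉)
mainTheorem2 n 4≤n = γ n , (upper-bound 4≤n , lower-bound 3≤n) , γ-formula 3≤n
  where
  3≤n : 3 ≤ n
  3≤n = ≤-trans (n≤1+n 3) 4≤n
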